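{- Let $G$ be a strongly regular graph with parameters $(v, k, \lambda, u)$ satisfying $2k - \lambda \neq u + 2$ and $v \neq 2k+1$. Then $G$ can be uniquely reconstructed from $T_3(G)$ given the value of $k$ and the fact that $G$ is strongly regular: if $G'$ is a strongly regular $k$-regular graph on the same vertex set with $T_3(G') = T_3(G)$, then $G' = G$.
   Context: Graphs are finite, simple, labeled; equality of labeled graphs means same vertex set and same edge set. A strongly regular graph with parameters $(v,k,\lambda,u)$ is a $k$-regular graph on $v$ vertices in which every two adjacent vertices have exactly $\lambda$ common neighbors and every two distinct non-adjacent vertices have exactly $u$ common neighbors. $T_3(G) = \{X \subseteq V(G) : |X| = 3 \text{ and the subgraph of } G \text{ induced by } X \text{ is connected}\}$ (the set of connected triples). -}

module Defs where

open import Data.Nat using (ℕ; _+_; _*_)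
open import Data.Bool using (Bool; true; false; _∧_)
open import Data.Fin using (Fin)
open import Data.Fin.Subset using (Subset; _∈_; ∣_∣)
open import Data.List using (List; length; filter; filterᵇ)
open import Data.List using () renaming (allFin to allFinL)
open import Data.Product using (_×_; Σ; ∃)
open import Relation.Binary.PropositionalEquality using (_≡_; _≢_)
open import Relation.Nullary using (¬_)
open import Function.Bundles using (_⇔_)

record Graph (n : ℕ) : Set where
  field
    adj     : Fin n → Fin n → Bool
    sym     : ∀ x y → adj x y ≡ adj y x
    irrefl  : ∀ x → adj x x ≡ false
open Graph public

Adj : ∀ {n} → Graph n → Fin n → Fin n → Set
Adj G x y = adj G x y ≡ true

SameGraph : ∀ {n} → Graph n → Graph n → Set
SameGraph G H = ∀ x y → (Adj G x y ⇔ Adj H x y)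

degree : ∀ {n} → Graph n → Fin n → ℕ
degree {n} G x = length (filterᵇ (adj G x) (allFinL n))

common : ∀ {n} → Graph n → Fin n → Fin n → ℕ
common {n} G x y = length (filterᵇ (λ z → adj G x z ∧ adj G y z) (allFinL n))

Regular : ∀ {n} → Graph n → ℕ → Set
Regular G k = ∀ x → degree G x ≡ k

IsSRG : ∀ {n} → Graph n → ℕ → ℕ → ℕ → ℕ → Set
IsSRG {n} G v k l u =
  (n ≡ v) × Regular G k
  × (∀ x y → Adj G x y → common G x y ≡ l)
  × (∀ x y → x ≢ y → ¬ Adj G x y → common G x y ≡ u)

StronglyRegular : ∀ {n} → Graph n → Set
StronglyRegular {n} G = Σ ℕ λ k → Σ ℕ λ l → Σ ℕ λ u → IsSRG G n k l u

data Reach {n} (G : Graph n) (X : Subset n) : Fin n → Fin n → Set where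
  here : ∀ {a} → Reach G X a a
  step : ∀ {a b c} → Adj G a b → b ∈ X → Reach G X b c → Reach G X a c

InducedConnected : ∀ {n} → Graph n → Subset n → Set
InducedConnected G X = ∀ a b → a ∈ X → b ∈ X → Reach G X a b

InT3 : ∀ {n} → Graph n → Subset n → Set
InT3 G X = (∣ X ∣ ≡ 3) × InducedConnected G X

SameT3 : ∀ {n} → Graph n → Graph n → Set
SameT3 G H = ∀ X → (InT3 G X ⇔ InT3 H X)

-- For distinct x, y let t(x, y) be the number of third vertices z with {x, y, z}
-- a connected triple; it depends only on T₃.  In a strongly regular graph
-- t(x, y) = 2k − λ − 2 when x ∼ y (z ranges over N(x) ∪ N(y) minus x, y) and
-- t(x, y) = μ otherwise, and 2k − λ ≠ μ + 2 makes the two values differ.  Hence,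
-- fixing x, two vertices equally adjacent to x in G′ are equally adjacent to x in
-- G.  Both neighbourhoods of x have size k, so if they differed anywhere they
-- would have to be complementary in V ∖ {x}, forcing v = 2k + 1.
module Submission where

open import Defs renaming (sym to adj-sym)
open import Data.Nat using (ℕ; zero; suc; _+_; _*_)
open import Data.Nat.Properties using (+-suc; +-comm; +-identityʳ; +-cancelˡ-≡; +-cancelʳ-≡)
open import Data.Bool using (Bool; true; false; _∧_; _∨_; not; if_then_else_)
open import Data.Bool.Properties using (∧-comm; ∨-comm; ∨-assoc; ⇔→≡) renaming (_≟_ to _≟ᵇ_)
open import Data.Fin using (Fin; zero; suc; _≟_)
open import Data.Fin.Subset using (Subset; _∈_; ∣_∣)
open import Data.List using (length; filterᵇ)
import Data.List as List
open import Data.Vec using (tabulate)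
open import Data.Vec.Properties using (tabulate-cong; lookup∘tabulate; []=⇒lookup; lookup⇒[]=)
open import Data.Product using (_×_; _,_; ∃; proj₁; proj₂)
open import Data.Sum using (_⊎_; inj₁; inj₂; [_,_])
open import Data.Empty using (⊥-elim)
open import Function using (_∘_; id; case_of_)
open import Function.Bundles using (_⇔_; mk⇔)
open import Function.Construct.Composition using (_⇔-∘_)
open import Function.Construct.Symmetry using (⇔-sym)
open import Relation.Binary.PropositionalEquality
  using (_≡_; _≢_; refl; sym; trans; cong; cong₂; subst; ≢-sym; module ≡-Reasoning)
open import Relation.Nullary using (¬_; does; yes; no; contradiction)

private
  variable
    n : ℕ
    x y z w : Fin n
    P Q : Fin n → Bool

count : (Fin n → Bool) → ℕ
count P = ∣ tabulate P ∣

_∖_ : (Fin n → Bool) → Fin n → (Fin n → Bool)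
(P ∖ x) z = not (does (z ≟ x)) ∧ P z

infixl 6 _∖_

length-filterᵇ-tabulate : ∀ {A : Set} (P : A → Bool) (f : Fin n → A) →
  length (filterᵇ P (List.tabulate f)) ≡ count (P ∘ f)
length-filterᵇ-tabulate {zero}  P f = refl
length-filterᵇ-tabulate {suc n} P f with P (f zero)
... | true  = cong suc (length-filterᵇ-tabulate P (f ∘ suc))
... | false = length-filterᵇ-tabulate P (f ∘ suc)

count-cong : (∀ z → P z ≡ Q z) → count P ≡ count Q
count-cong eq = cong ∣_∣ (tabulate-cong eq)

count-≡0 : (∀ z → P z ≡ false) → count P ≡ 0
count-≡0 {zero} none = refl
count-≡0 {suc n} {P} none rewrite none zero = count-≡0 {P = P ∘ suc} (none ∘ suc)

count-∨-∧ : ∀ (P Q : Fin n → Bool) →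
  count (λ z → P z ∨ Q z) + count (λ z → P z ∧ Q z) ≡ count P + count Q
count-∨-∧ {zero} P Q = refl
count-∨-∧ {suc n} P Q with P zero | Q zero | count-∨-∧ (P ∘ suc) (Q ∘ suc)
... | true  | true  | ih = cong suc (trans (+-suc _ _) (trans (cong suc ih) (sym (+-suc _ _))))
... | true  | false | ih = cong suc ih
... | false | true  | ih = trans (cong suc ih) (sym (+-suc _ _))
... | false | false | ih = ih

count-not : ∀ (P : Fin n → Bool) → count P + count (not ∘ P) ≡ n
count-not {zero} P = refl
count-not {suc n} P with P zero | count-not (P ∘ suc)
... | true  | ih = cong suc ih
... | false | ih = trans (+-suc _ _) (cong suc ih)

count-split : ∀ (P Q : Fin n → Bool) →
  count P ≡ count (λ z → P z ∧ Q z) + count (λ z → P z ∧ not (Q z))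
count-split {zero} P Q = refl
count-split {suc n} P Q with P zero | Q zero | count-split (P ∘ suc) (Q ∘ suc)
... | true  | true  | ih = cong suc ih
... | true  | false | ih = trans (cong suc ih) (sym (+-suc _ _))
... | false | _     | ih = ih

count-∖ : ∀ (P : Fin n → Bool) x → P x ≡ true → count P ≡ suc (count (P ∖ x))
count-∖ P zero    Px rewrite Px = refl
count-∖ P (suc x) Px with P zero
... | true  = cong suc (count-∖ (P ∘ suc) x Px)
... | false = count-∖ (P ∘ suc) x Px

∖-≢ : ∀ (P : Fin n → Bool) → y ≢ x → (P ∖ x) y ≡ P y
∖-≢ {y = y} {x} P y≢x with y ≟ x
... | yes y≡x = contradiction y≡x y≢x
... | no  _   = refl

∖-cong : (∀ z → P z ≡ Q z) → ∀ z → (P ∖ x) z ≡ (Q ∖ x) z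
∖-cong {x = x} P≗Q z = cong (not (does (z ≟ x)) ∧_) (P≗Q z)

∖-absent : ∀ (P : Fin n → Bool) → P x ≡ false → ∀ z → (P ∖ x) z ≡ P z
∖-absent {x = x} P Px z with z ≟ x
... | yes refl = sym Px
... | no  _    = refl

count≢0⇒∃ : count P ≢ 0 → ∃ λ z → P z ≡ true
count≢0⇒∃ {zero} ≢0 = contradiction refl ≢0
count≢0⇒∃ {suc n} {P} ≢0 with P zero in P0
... | true  = zero , P0
... | false with count≢0⇒∃ {P = P ∘ suc} ≢0
...   | z , Pz = suc z , Pz

∃⇒count≢0 : ∀ (P : Fin n → Bool) z → P z ≡ true → count P ≢ 0
∃⇒count≢0 P z Pz count≡0 with () ← trans (sym (count-∖ P z Pz)) count≡0

count-difference-sym : ∀ (P Q : Fin n → Bool) → count P ≡ count Q →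
  count (λ z → P z ∧ not (Q z)) ≡ count (λ z → Q z ∧ not (P z))
count-difference-sym P Q P≡Q = +-cancelˡ-≡ (count (λ z → P z ∧ Q z)) _ _ (begin
  count (λ z → P z ∧ Q z) + count (λ z → P z ∧ not (Q z))  ≡⟨ count-split P Q ⟨
  count P                                                  ≡⟨ P≡Q ⟩
  count Q                                                  ≡⟨ count-split Q P ⟩
  count (λ z → Q z ∧ P z) + count (λ z → Q z ∧ not (P z))  ≡⟨ cong (_+ count (λ z → Q z ∧ not (P z)))
                                                                  (count-cong λ z → ∧-comm (Q z) (P z)) ⟩
  count (λ z → P z ∧ Q z) + count (λ z → Q z ∧ not (P z))  ∎)
  where open ≡-Reasoning

∧-not≡true : ∀ {a b} → a ∧ not b ≡ true → a ≡ true × b ≡ false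
∧-not≡true {true}  {false} _ = refl , refl
∧-not≡true {true}  {true}  ()
∧-not≡true {false}         ()

difference-witness : count P ≡ count Q → P y ≡ true → Q y ≡ false →
  ∃ λ z → P z ≡ false × Q z ≡ true
difference-witness {P = P} {Q} {y} P≡Q Py Qy =
  let z , onlyQ = count≢0⇒∃ onlyQ-nonempty ; Qz , Pz = ∧-not≡true onlyQ in z , Pz , Qz
  where
  onlyQ-nonempty : count (λ z → Q z ∧ not (P z)) ≢ 0
  onlyQ-nonempty = ∃⇒count≢0 (λ z → P z ∧ not (Q z)) y (cong₂ (λ a b → a ∧ not b) Py Qy)
                 ∘ trans (count-difference-sym P Q P≡Q)

opposite-witnesses : ∀ (P Q : Fin n → Bool) → count P ≡ count Q → P y ≢ Q y →
  (∃ λ w → P w ≡ true × Q w ≡ false) × (∃ λ w → P w ≡ false × Q w ≡ true)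
opposite-witnesses {y = y} P Q P≡Q Py≢Qy with P y in Py | Q y in Qy
... | true  | false = (y , Py , Qy) , difference-witness P≡Q Py Qy
... | false | true  = let w , Qw , Pw = difference-witness (sym P≡Q) Qy Py
                      in (w , Pw , Qw) , (y , Py , Qy)
... | true  | true  = contradiction refl Py≢Qy
... | false | false = contradiction refl Py≢Qy

values⇒≢ : ∀ {A : Set} (f : A → Bool) {a b} → f a ≡ true → f b ≡ false → a ≢ b
values⇒≢ f fa fb refl with () ← trans (sym fa) fb

disagreement⇒complementary : ∀ (P Q : Fin n → Bool) x → P x ≡ false → Q x ≡ false →
  count P ≡ count Q → (∀ {w z} → w ≢ x → z ≢ x → Q w ≡ Q z → P w ≡ P z) →
  P y ≢ Q y → n ≡ suc (count P + count Q)
disagreement⇒complementary {n} P Q x Px Qx P≡Q determined Py≢Qy = begin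
  n                                    ≡⟨ count-not P ⟨
  count P + count (not ∘ P)            ≡⟨ cong (count P +_) (count-∖ (not ∘ P) x (cong not Px)) ⟩
  count P + suc (count (not ∘ P ∖ x))  ≡⟨ cong (λ c → count P + suc c) (count-cong complementary) ⟨
  count P + suc (count Q)              ≡⟨ +-suc (count P) (count Q) ⟩
  suc (count P + count Q)              ∎
  where
  open ≡-Reasoning
  complementary : ∀ z → Q z ≡ (not ∘ P ∖ x) z
  complementary z with z ≟ x | opposite-witnesses P Q P≡Q Py≢Qy
  ... | yes refl | _ = Qx
  ... | no z≢x   | (w₁ , Pw₁ , Qw₁) , (w₂ , Pw₂ , Qw₂) with Q z in Qz
  -- z has the same Q-value as w₁ or as w₂, hence also the same P-value.
  ...   | false = cong not (sym (trans (determined z≢x (values⇒≢ P Pw₁ Px) (trans Qz (sym Qw₁))) Pw₁))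
  ...   | true  = cong not (sym (trans (determined z≢x (values⇒≢ Q Qw₂ Qx) (trans Qz (sym Qw₂))) Pw₂))

degree≡count : ∀ (G : Graph n) x → degree G x ≡ count (adj G x)
degree≡count G x = length-filterᵇ-tabulate (adj G x) id

common≡count : ∀ (G : Graph n) x y → common G x y ≡ count (λ z → adj G x z ∧ adj G y z)
common≡count G x y = length-filterᵇ-tabulate (λ z → adj G x z ∧ adj G y z) id

tripleᵇ : Fin n → Fin n → Fin n → Fin n → Bool
tripleᵇ x y z w = does (w ≟ x) ∨ does (w ≟ y) ∨ does (w ≟ z)

triple : Fin n → Fin n → Fin n → Subset n
triple x y z = tabulate (tripleᵇ x y z)

tripleᵇ⁺ : ∀ (x y z : Fin n) → w ≡ x ⊎ w ≡ y ⊎ w ≡ z → tripleᵇ x y z w ≡ true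
tripleᵇ⁺ {w = w} x y z w∈ with w ≟ x | w ≟ y | w ≟ z
... | yes _   | _       | _       = refl
... | no _    | yes _   | _       = refl
... | no _    | no _    | yes _   = refl
... | no w≢x  | no w≢y  | no w≢z  = ⊥-elim ([ w≢x , [ w≢y , w≢z ] ] w∈)

tripleᵇ⁻ : tripleᵇ x y z w ≡ true → w ≡ x ⊎ w ≡ y ⊎ w ≡ z
tripleᵇ⁻ {x = x} {y} {z} {w} w∈ with w ≟ x | w ≟ y | w ≟ z
... | yes w≡x | _       | _       = inj₁ w≡x
... | no _    | yes w≡y | _       = inj₂ (inj₁ w≡y)
... | no _    | no _    | yes w≡z = inj₂ (inj₂ w≡z)
... | no _    | no _    | no _ with () ← w∈

∈-triple⁺ : w ≡ x ⊎ w ≡ y ⊎ w ≡ z → w ∈ triple x y z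
∈-triple⁺ {w = w} w∈ = lookup⇒[]= w _ (trans (lookup∘tabulate _ w) (tripleᵇ⁺ _ _ _ w∈))

∈-triple⁻ : w ∈ triple x y z → w ≡ x ⊎ w ≡ y ⊎ w ≡ z
∈-triple⁻ {w = w} w∈ = tripleᵇ⁻ (trans (sym (lookup∘tabulate _ w)) ([]=⇒lookup w∈))

∣triple∣≡3 : x ≢ y → x ≢ z → y ≢ z → ∣ triple x y z ∣ ≡ 3
∣triple∣≡3 {x = x} {y} {z} x≢y x≢z y≢z = begin
  count T                      ≡⟨ count-∖ T x (tripleᵇ⁺ x y z (inj₁ refl)) ⟩
  suc (count (T ∖ x))          ≡⟨ cong suc (count-∖ (T ∖ x) y Ty) ⟩
  2 + count (T ∖ x ∖ y)        ≡⟨ cong (2 +_) (count-∖ (T ∖ x ∖ y) z Tz) ⟩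
  3 + count (T ∖ x ∖ y ∖ z)    ≡⟨ cong (3 +_) (count-≡0 exhausted) ⟩
  3                            ∎
  where
  open ≡-Reasoning
  T = tripleᵇ x y z
  Ty : (T ∖ x) y ≡ true
  Ty = trans (∖-≢ T (≢-sym x≢y)) (tripleᵇ⁺ x y z (inj₂ (inj₁ refl)))
  Tz : (T ∖ x ∖ y) z ≡ true
  Tz = trans (∖-≢ (T ∖ x) (≢-sym y≢z))
             (trans (∖-≢ T (≢-sym x≢z)) (tripleᵇ⁺ x y z (inj₂ (inj₂ refl))))
  exhausted : ∀ w → (T ∖ x ∖ y ∖ z) w ≡ false
  exhausted w with w ≟ x | w ≟ y | w ≟ z
  ... | _     | _     | yes _ = refl
  ... | _     | yes _ | no _  = refl
  ... | yes _ | no _  | no _  = refl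
  ... | no _  | no _  | no _  = refl

adj-flip : ∀ (G : Graph n) {b} → adj G x y ≡ b → adj G y x ≡ b
adj-flip {x = x} {y} G = trans (adj-sym G y x)

module _ (G : Graph n) {X : Subset n} where

  reach-++ : Reach G X x y → Reach G X y z → Reach G X x z
  reach-++ here          q = q
  reach-++ (step e m p) q = step e m (reach-++ p q)

  star⇒connected : y ∈ X → (∀ {w} → w ∈ X → w ≡ y ⊎ Adj G y w) → InducedConnected G X
  star⇒connected {y = c} c∈X star a b a∈X b∈X = reach-++ (to-centre a∈X) (from-centre b∈X)
    where
    to-centre : w ∈ X → Reach G X w c
    to-centre {w} w∈X with star w∈X
    ... | inj₁ refl = here
    ... | inj₂ cw   = step (adj-flip G cw) c∈X here
    from-centre : w ∈ X → Reach G X c w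
    from-centre {w} w∈X with star w∈X
    ... | inj₁ refl = here
    ... | inj₂ cw   = step cw w∈X here

  isolated⇒unreachable : (∀ {w} → w ∈ X → adj G x w ≡ false) → x ≢ y → ¬ Reach G X x y
  isolated⇒unreachable isolated x≢y here               = x≢y refl
  isolated⇒unreachable isolated x≢y (step xw w∈X _) with () ← trans (sym xw) (isolated w∈X)

triple-swap : triple x y z ≡ triple y x z
triple-swap = tabulate-cong λ w → ∨-swap (does (w ≟ _)) (does (w ≟ _)) (does (w ≟ _))
  where
  ∨-swap : ∀ a b c → a ∨ b ∨ c ≡ b ∨ a ∨ c
  ∨-swap a b c = trans (sym (∨-assoc a b c)) (trans (cong (_∨ c) (∨-comm a b)) (∨-assoc b a c))

triple-rotate : triple x y z ≡ triple z x y
triple-rotate = tabulate-cong λ w → ∨-rotate (does (w ≟ _)) (does (w ≟ _)) (does (w ≟ _))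
  where
  ∨-rotate : ∀ a b c → a ∨ b ∨ c ≡ c ∨ a ∨ b
  ∨-rotate a b c = trans (sym (∨-assoc a b c)) (∨-comm (a ∨ b) c)

triple-star : ∀ (G : Graph n) → Adj G x y → Adj G x z → InducedConnected G (triple x y z)
triple-star G xy xz = star⇒connected G (∈-triple⁺ (inj₁ refl)) λ w∈ →
  case ∈-triple⁻ w∈ of λ where
    (inj₁ w≡x)         → inj₁ w≡x
    (inj₂ (inj₁ refl)) → inj₂ xy
    (inj₂ (inj₂ refl)) → inj₂ xz

triple-isolated : ∀ (G : Graph n) → x ≢ y → adj G x y ≡ false → adj G x z ≡ false →
  ¬ InducedConnected G (triple x y z)
triple-isolated {x = x} G x≢y xy xz connected =
  isolated⇒unreachable G isolated x≢y
    (connected _ _ (∈-triple⁺ (inj₁ refl)) (∈-triple⁺ (inj₂ (inj₁ refl))))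
  where
  isolated : w ∈ triple x _ _ → adj G x w ≡ false
  isolated w∈ with ∈-triple⁻ w∈
  ... | inj₁ refl        = irrefl G x
  ... | inj₂ (inj₁ refl) = xy
  ... | inj₂ (inj₂ refl) = xz

connectedᵇ : Graph n → Fin n → Fin n → Fin n → Bool
connectedᵇ G x y z = if adj G x y then adj G x z ∨ adj G y z else adj G x z ∧ adj G y z

connectedᵇ⇒connected : ∀ (G : Graph n) → connectedᵇ G x y z ≡ true →
  InducedConnected G (triple x y z)
connectedᵇ⇒connected {x = x} {y} {z} G c with adj G x y in xy | adj G x z in xz | adj G y z in yz
... | true  | true  | _     = triple-star G xy xz
... | true  | false | true  = subst (InducedConnected G) (sym triple-swap) (triple-star G (adj-flip G xy) yz)
... | false | true  | true  = subst (InducedConnected G) (sym triple-rotate)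
                                (triple-star G (adj-flip G xz) (adj-flip G yz))
... | true  | false | false = contradiction c λ ()
... | false | false | _     = contradiction c λ ()
... | false | true  | false = contradiction c λ ()

connected⇒connectedᵇ : ∀ (G : Graph n) → x ≢ y → x ≢ z → y ≢ z →
  InducedConnected G (triple x y z) → connectedᵇ G x y z ≡ true
connected⇒connectedᵇ {x = x} {y} {z} G x≢y x≢z y≢z connected
  with adj G x y in xy | adj G x z in xz | adj G y z in yz
... | true  | true  | _     = refl
... | true  | false | true  = refl
... | false | true  | true  = refl
... | false | false | _     = ⊥-elim (triple-isolated G x≢y xy xz connected)
... | true  | false | false = ⊥-elim (triple-isolated G (≢-sym x≢z) (adj-flip G xz)
                                (adj-flip G yz) (subst (InducedConnected G) triple-rotate connected))
... | false | true  | false = ⊥-elim (triple-isolated G (≢-sym x≢y) (adj-flip G xy) yz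
                                (subst (InducedConnected G) triple-swap connected))

connectedᵇ⇔InT3 : ∀ (G : Graph n) → x ≢ y → x ≢ z → y ≢ z →
  connectedᵇ G x y z ≡ true ⇔ InT3 G (triple x y z)
connectedᵇ⇔InT3 G x≢y x≢z y≢z = mk⇔
  (λ c → ∣triple∣≡3 x≢y x≢z y≢z , connectedᵇ⇒connected G c)
  (connected⇒connectedᵇ G x≢y x≢z y≢z ∘ proj₂)

connectedᵇ-cong : ∀ (G G′ : Graph n) → SameT3 G′ G → x ≢ y → x ≢ z → y ≢ z →
  connectedᵇ G′ x y z ≡ connectedᵇ G x y z
connectedᵇ-cong G G′ same x≢y x≢z y≢z = ⇔→≡
  (⇔-sym (connectedᵇ⇔InT3 G x≢y x≢z y≢z)
   ⇔-∘ (same _ ⇔-∘ connectedᵇ⇔InT3 G′ x≢y x≢z y≢z))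

triplesThrough : Graph n → Fin n → Fin n → ℕ
triplesThrough G x y = count (connectedᵇ G x y ∖ x ∖ y)

triplesThrough-cong : ∀ (G G′ : Graph n) → SameT3 G′ G → x ≢ y →
  triplesThrough G′ x y ≡ triplesThrough G x y
triplesThrough-cong {x = x} {y} G G′ same x≢y = count-cong λ z → helper z
  where
  helper : ∀ z → (connectedᵇ G′ x y ∖ x ∖ y) z ≡ (connectedᵇ G x y ∖ x ∖ y) z
  helper z with z ≟ x | z ≟ y
  ... | _       | yes _   = refl
  ... | yes _   | no _    = refl
  ... | no z≢x  | no z≢y  = connectedᵇ-cong G G′ same x≢y (≢-sym z≢x) (≢-sym z≢y)

triplesThrough+common : ∀ (G : Graph n) → Adj G x y →
  triplesThrough G x y + 2 + common G x y ≡ degree G x + degree G y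
triplesThrough+common {n} {x} {y} G xy = begin
  triplesThrough G x y + 2 + common G x y  ≡⟨ cong₂ _+_ (+-comm (triplesThrough G x y) 2)
                                                         (common≡count G x y) ⟩
  2 + triplesThrough G x y + count both    ≡⟨ cong (λ t → 2 + t + count both)
                                                   (count-cong (∖-cong (∖-cong connected≗either))) ⟩
  2 + count (either ∖ x ∖ y) + count both  ≡⟨ cong (_+ count both) two-removed ⟨
  count either + count both                ≡⟨ count-∨-∧ (adj G x) (adj G y) ⟩
  count (adj G x) + count (adj G y)        ≡⟨ cong₂ _+_ (degree≡count G x) (degree≡count G y) ⟨
  degree G x + degree G y                  ∎
  where
  open ≡-Reasoning
  either both : Fin n → Bool
  either z = adj G x z ∨ adj G y z
  both z = adj G x z ∧ adj G y z
  connected≗either : ∀ z → connectedᵇ G x y z ≡ either z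
  connected≗either z = cong (λ b → if b then either z else both z) xy
  two-removed : count either ≡ 2 + count (either ∖ x ∖ y)
  two-removed = trans (count-∖ either x (cong₂ _∨_ (irrefl G x) (adj-flip G xy)))
    (cong suc (count-∖ (either ∖ x) y
      (trans (∖-≢ either (values⇒≢ (adj G x) xy (irrefl G x))) (cong (_∨ adj G y y) xy))))

triplesThrough≡common : ∀ (G : Graph n) → adj G x y ≡ false → triplesThrough G x y ≡ common G x y
triplesThrough≡common {n} {x} {y} G xy = trans (count-cong both-only) (sym (common≡count G x y))
  where
  both : Fin n → Bool
  both z = adj G x z ∧ adj G y z
  both-x : both x ≡ false
  both-x = cong (_∧ adj G y x) (irrefl G x)
  both-y : both y ≡ false
  both-y = cong (_∧ adj G y y) xy
  connected≗both : ∀ z → connectedᵇ G x y z ≡ both z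
  connected≗both z = cong (λ b → if b then adj G x z ∨ adj G y z else both z) xy
  both-only : ∀ z → (connectedᵇ G x y ∖ x ∖ y) z ≡ both z
  both-only z = begin
    (connectedᵇ G x y ∖ x ∖ y) z  ≡⟨ ∖-cong (∖-cong connected≗both) z ⟩
    (both ∖ x ∖ y) z               ≡⟨ ∖-absent (both ∖ x) (trans (∖-absent both both-x y) both-y) z ⟩
    (both ∖ x) z                   ≡⟨ ∖-absent both both-x z ⟩
    both z                         ∎
    where open ≡-Reasoning

module _ (H : Graph n) {v k l u : ℕ} (srg : IsSRG H v k l u) where

  private
    regular : Regular H k
    regular = proj₁ (proj₂ srg)
    λ-law : ∀ x y → Adj H x y → common H x y ≡ l
    λ-law = proj₁ (proj₂ (proj₂ srg))
    μ-law : ∀ x y → x ≢ y → ¬ Adj H x y → common H x y ≡ u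
    μ-law = proj₂ (proj₂ (proj₂ srg))

  srg-triplesThrough-adj : Adj H x y → triplesThrough H x y + 2 + l ≡ 2 * k
  srg-triplesThrough-adj {x} {y} xy = begin
    triplesThrough H x y + 2 + l              ≡⟨ cong (triplesThrough H x y + 2 +_) (λ-law x y xy) ⟨
    triplesThrough H x y + 2 + common H x y   ≡⟨ triplesThrough+common H xy ⟩
    degree H x + degree H y                   ≡⟨ cong₂ _+_ (regular x) (regular y) ⟩
    k + k                                     ≡⟨ cong (k +_) (+-identityʳ k) ⟨
    2 * k                                     ∎
    where open ≡-Reasoning

  srg-triplesThrough-nonadj : x ≢ y → adj H x y ≡ false → triplesThrough H x y ≡ u
  srg-triplesThrough-nonadj {x} {y} x≢y xy =
    trans (triplesThrough≡common H xy)
          (μ-law x y x≢y λ xy′ → contradiction (trans (sym xy) xy′) λ ())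

  srg-triplesThrough-determined : x ≢ y → x ≢ z → adj H x y ≡ adj H x z →
    triplesThrough H x y ≡ triplesThrough H x z
  srg-triplesThrough-determined {x} {y} {z} x≢y x≢z agree = by-adjacency (adj H x y) refl (sym agree)
    where
    by-adjacency : ∀ b → adj H x y ≡ b → adj H x z ≡ b →
      triplesThrough H x y ≡ triplesThrough H x z
    by-adjacency true  xy xz = +-cancelʳ-≡ 2 _ _ (+-cancelʳ-≡ l _ _
      (trans (srg-triplesThrough-adj xy) (sym (srg-triplesThrough-adj xz))))
    by-adjacency false xy xz =
      trans (srg-triplesThrough-nonadj x≢y xy) (sym (srg-triplesThrough-nonadj x≢z xz))

  srg-triplesThrough-adj≢u : 2 * k ≢ u + 2 + l → Adj H x y → triplesThrough H x y ≢ u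
  srg-triplesThrough-adj≢u separated xy ≡u =
    separated (trans (sym (srg-triplesThrough-adj xy)) (cong (λ t → t + 2 + l) ≡u))

  srg-triplesThrough-injective : 2 * k ≢ u + 2 + l → x ≢ y → x ≢ z →
    triplesThrough H x y ≡ triplesThrough H x z → adj H x y ≡ adj H x z
  srg-triplesThrough-injective {x} {y} {z} separated x≢y x≢z same =
    by-adjacency (adj H x y) (adj H x z) refl refl
    where
    by-adjacency : ∀ b c → adj H x y ≡ b → adj H x z ≡ c → adj H x y ≡ adj H x z
    by-adjacency true  true  xy xz = trans xy (sym xz)
    by-adjacency false false xy xz = trans xy (sym xz)
    by-adjacency true  false xy xz = contradiction (trans same (srg-triplesThrough-nonadj x≢z xz))
                                       (srg-triplesThrough-adj≢u separated xy)
    by-adjacency false true  xy xz = contradiction (trans (sym same) (srg-triplesThrough-nonadj x≢y xy))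
                                       (srg-triplesThrough-adj≢u separated xz)

adjacency-determined-by-T3 : ∀ {G G′ : Graph n} {v k l u v′ k′ l′ u′ : ℕ} {x y z : Fin n} →
  IsSRG G v k l u → 2 * k ≢ u + 2 + l → IsSRG G′ v′ k′ l′ u′ → SameT3 G′ G →
  y ≢ x → z ≢ x → adj G′ x y ≡ adj G′ x z → adj G x y ≡ adj G x z
adjacency-determined-by-T3 {G = G} {G′} {x = x} {y} {z} srg separated srg′ same y≢x z≢x agree′ =
  srg-triplesThrough-injective G srg separated x≢y x≢z (begin
    triplesThrough G x y   ≡⟨ triplesThrough-cong G G′ same x≢y ⟨
    triplesThrough G′ x y  ≡⟨ srg-triplesThrough-determined G′ srg′ x≢y x≢z agree′ ⟩
    triplesThrough G′ x z  ≡⟨ triplesThrough-cong G G′ same x≢z ⟩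
    triplesThrough G x z   ∎)
  where
  open ≡-Reasoning
  x≢y = ≢-sym y≢x
  x≢z = ≢-sym z≢x

adjacency-disagreement⇒order : ∀ {G G′ : Graph n} {v k l u v′ k′ l′ u′ : ℕ} {x y : Fin n} →
  IsSRG G v k l u → 2 * k ≢ u + 2 + l → IsSRG G′ v′ k′ l′ u′ → Regular G′ k →
  SameT3 G′ G → adj G x y ≢ adj G′ x y → n ≡ 2 * k + 1
adjacency-disagreement⇒order {n} {G} {G′} {k = k} {x = x}
  srg@(_ , regular , _) separated srg′ regular′ same disagree = begin
  n                                        ≡⟨ disagreement⇒complementary (adj G x) (adj G′ x) x
                                                (irrefl G x) (irrefl G′ x) equal-degrees determined disagree ⟩
  suc (count (adj G x) + count (adj G′ x)) ≡⟨ cong suc (cong₂ _+_ (degree-k G regular) (degree-k G′ regular′)) ⟩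
  suc (k + k)                              ≡⟨ cong (λ m → suc (k + m)) (+-identityʳ k) ⟨
  suc (2 * k)                              ≡⟨ +-comm 1 (2 * k) ⟩
  2 * k + 1                                ∎
  where
  open ≡-Reasoning
  degree-k : ∀ (H : Graph n) → Regular H k → count (adj H x) ≡ k
  degree-k H regular = trans (sym (degree≡count H x)) (regular x)
  equal-degrees : count (adj G x) ≡ count (adj G′ x)
  equal-degrees = trans (degree-k G regular) (sym (degree-k G′ regular′))
  determined : ∀ {w z} → w ≢ x → z ≢ x → adj G′ x w ≡ adj G′ x z → adj G x w ≡ adj G x z
  determined = adjacency-determined-by-T3 srg separated srg′ same

theorem2p5 : ∀ {n} (G G′ : Graph n) (v k l u : ℕ) →
    IsSRG G v k l u →
    2 * k ≢ u + 2 + l →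
    v ≢ 2 * k + 1 →
    StronglyRegular G′ → Regular G′ k →
    SameT3 G′ G →
    SameGraph G′ G
theorem2p5 G G′ v k l u srg@(n≡v , _) separated v≢2k+1 (_ , _ , _ , srg′) regular′ same x y
  with adj G x y ≟ᵇ adj G′ x y
... | yes agree    = mk⇔ (trans agree) (trans (sym agree))
... | no disagree = contradiction
  (trans (sym n≡v) (adjacency-disagreement⇒order srg separated srg′ regular′ same disagree)) v≢2k+1
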